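{- Let $X\in\{LD,LTD,OLD\}$ and let $G$ be a graph admitting an $X$-set. Then $\gamma_X(M(G))\le 2\gamma_X(G)$.
   Context: All graphs are finite, simple and connected. For a graph $G=(V,E)$ and $x\in V$, $N(x)$ is the open neighbourhood and $N[x]=N(x)\cup\{x\}$. A set $C\subseteq V$ is dominating if $N[x]\cap C\ne\emptyset$ for all $x\in V$, and total-dominating if $N(x)\cap C\neq\emptyset$ for all $x\in V$. $C$ is a locating-dominating set ($LD$-set) if it is dominating and $N(x)\cap C\ne N(y)\cap C$ for all distinct $x,y\in V\setminus C$; a locating total-dominating set ($LTD$-set) if it is total-dominating and $N(x)\cap C\ne N(y)\cap C$ for all distinct $x,y\in V\setminus C$; an open locating-dominating set ($OLD$-set) if it is total-dominating and $N(x)\cap C\neq N(y)\cap C$ for all distinct $x,y\in V$. For $X\in\{LD,LTD,OLD\}$, $\gamma_X(G)$ is the minimum size of an $X$-set of $G$. The Mycielski graph $M(G)$ of $G$ with $V=\{v_1,\dots,v_n\}$ is obtained from $G$ by adding, for each $i$, a new vertex $u_i$ adjacent to every vertex of $N_G(v_i)$, and then adding one further vertex $u$ adjacent to all of $u_1,\dots,u_n$ (and to nothing else). -}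

module Defs where

open import Data.Nat using (ℕ; zero; suc; _+_; _*_; _≤_; _<_)
open import Data.Bool using (Bool; true; false)
open import Data.Fin using (Fin; zero; suc; splitAt)
open import Data.Fin.Subset using (Subset; _∈_; _∩_; ∣_∣; Nonempty; _∉_)
open import Data.Vec using (tabulate)
open import Data.Sum using (_⊎_; inj₁; inj₂)
open import Data.Product using (Σ; _×_; _,_)
open import Relation.Binary.PropositionalEquality using (_≡_; _≢_)

record SimpleGraph (n : ℕ) : Set where
  field
    adj   : Fin n → Fin n → Bool
    sym   : ∀ x y → adj x y ≡ adj y x
    irrefl : ∀ x → adj x x ≡ false
open SimpleGraph public

data Reach {n : ℕ} (G : SimpleGraph n) : Fin n → Fin n → Set where
  here : ∀ {x} → Reach G x x
  step : ∀ {x y z} → adj G x y ≡ true → Reach G y z → Reach G x z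

Connected : ∀ {n} → SimpleGraph n → Set
Connected {n} G = (0 < n) × (∀ x y → Reach G x y)

N : ∀ {n} → SimpleGraph n → Fin n → Subset n
N G x = tabulate (adj G x)

N[_] : ∀ {n} → SimpleGraph n → Fin n → Subset n
N[ G ] x = tabulate (λ y → closed y)
  where
  open import Data.Fin using (_≟_)
  open import Relation.Nullary using (yes; no)
  closed : _ → Bool
  closed y with x ≟ y
  ... | yes _ = true
  ... | no  _ = adj G x y

Dominating : ∀ {n} → SimpleGraph n → Subset n → Set
Dominating G C = ∀ x → Nonempty (N[ G ] x ∩ C)

TotalDominating : ∀ {n} → SimpleGraph n → Subset n → Set
TotalDominating G C = ∀ x → Nonempty (N G x ∩ C)

IsLD : ∀ {n} → SimpleGraph n → Subset n → Set
IsLD G C = Dominating G C ×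
  (∀ x y → x ∉ C → y ∉ C → x ≢ y → N G x ∩ C ≢ N G y ∩ C)

IsLTD : ∀ {n} → SimpleGraph n → Subset n → Set
IsLTD G C = TotalDominating G C ×
  (∀ x y → x ∉ C → y ∉ C → x ≢ y → N G x ∩ C ≢ N G y ∩ C)

IsOLD : ∀ {n} → SimpleGraph n → Subset n → Set
IsOLD G C = TotalDominating G C ×
  (∀ x y → x ≢ y → N G x ∩ C ≢ N G y ∩ C)

data Kind : Set where
  LD LTD OLD : Kind

IsXSet : Kind → ∀ {n} → SimpleGraph n → Subset n → Set
IsXSet LD  G C = IsLD G C
IsXSet LTD G C = IsLTD G C
IsXSet OLD G C = IsOLD G C

IsGamma : Kind → ∀ {n} → SimpleGraph n → ℕ → Set
IsGamma X {n} G k =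
  (Σ (Subset n) λ C → IsXSet X G C × ∣ C ∣ ≡ k) ×
  (∀ (C : Subset n) → IsXSet X G C → k ≤ ∣ C ∣)

-- Mycielski graph. Vertex set Fin (suc (n + n)):
--   zero            = u
--   suc (i ↑ˡ n)    = v_i   (splitAt n gives inj₁ i)
--   suc (n ↑ʳ i)    = u_i   (splitAt n gives inj₂ i)
data MVert (n : ℕ) : Set where
  vu : MVert n
  vv : Fin n → MVert n
  vu' : Fin n → MVert n

classify : ∀ {n} → Fin (suc (n + n)) → MVert n
classify zero = vu
classify {n} (suc i) with splitAt n i
... | inj₁ a = vv a
... | inj₂ b = vu' b

madj : ∀ {n} → SimpleGraph n → MVert n → MVert n → Bool
madj G vu      vu      = false
madj G vu      (vv _)  = false
madj G vu      (vu' _) = true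
madj G (vv _)  vu      = false
madj G (vv a)  (vv b)  = adj G a b
madj G (vv a)  (vu' b) = adj G a b
madj G (vu' _) vu      = true
madj G (vu' a) (vv b)  = adj G a b
madj G (vu' _) (vu' _) = false

private
  madj-sym : ∀ {n} (G : SimpleGraph n) x y → madj G x y ≡ madj G y x
  madj-sym G vu vu = Relation.Binary.PropositionalEquality.refl
  madj-sym G vu (vv _) = Relation.Binary.PropositionalEquality.refl
  madj-sym G vu (vu' _) = Relation.Binary.PropositionalEquality.refl
  madj-sym G (vv _) vu = Relation.Binary.PropositionalEquality.refl
  madj-sym G (vv a) (vv b) = sym G a b
  madj-sym G (vv a) (vu' b) = sym G a b
  madj-sym G (vu' _) vu = Relation.Binary.PropositionalEquality.refl
  madj-sym G (vu' a) (vv b) = sym G a b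
  madj-sym G (vu' _) (vu' _) = Relation.Binary.PropositionalEquality.refl

  madj-irr : ∀ {n} (G : SimpleGraph n) x → madj G x x ≡ false
  madj-irr G vu = Relation.Binary.PropositionalEquality.refl
  madj-irr G (vv a) = irrefl G a
  madj-irr G (vu' _) = Relation.Binary.PropositionalEquality.refl

M : ∀ {n} → SimpleGraph n → SimpleGraph (suc (n + n))
M G = record
  { adj    = λ x y → madj G (classify x) (classify y)
  ; sym    = λ x y → madj-sym G (classify x) (classify y)
  ; irrefl = λ x → madj-irr G (classify x)
  }

{-# OPTIONS --safe #-}
-- If S is an X-set of G, then so is the set of both copies v_i, u_i (i ∈ S) in M(G),
-- which has 2|S| elements. Domination: u sees the u-copies, while v_j and u_j see the
-- v-copies of the neighbours of j in S. Location: on the v-copies, v_j and u_j have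
-- the trace of j in G, which separates v_j from v_j′ and u_j from u_j′. As no u_j sees
-- a u-copy, u and every v_j are told apart from the u_j by the u-copies, and u is told
-- apart from the v_j by the v-copies.
-- Then γ_X(M(G)) exists since X-sets form a decidable family of subsets of a finite set.
module Submission where

open import Defs hiding (sym)
open import Data.Nat using (ℕ; _≤_; _*_)
open import Data.Fin.Subset using (Subset)
open import Data.Product using (Σ; _×_)

open import Data.Bool using (true; false)
import Data.Bool.Properties as Bool
open import Data.Fin using (Fin; zero; suc; _≟_; _↑ˡ_; _↑ʳ_; splitAt; fromℕ<)
open import Data.Fin.Properties using (all?; splitAt-↑ˡ; splitAt-↑ʳ; join-splitAt)
open import Data.Fin.Subset
  using (_∈_; _∉_; _⊆_; _∩_; ∣_∣; Nonempty; inside; outside)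
open import Data.Fin.Subset.Properties
  using (_∈?_; nonempty?; anySubset?; x∈p∩q⁺; x∈p∩q⁻; p∩q⊆p; p∩q⊆q; ⊆-antisym)
open import Data.Nat using (suc; _+_; _<_; _<?_)
open import Data.Nat.Induction using (<-wellFounded)
open import Data.Nat.Properties
  using (+-identityʳ; ≤-refl; ≤-trans; <⇒≤; ≮⇒≥; module ≤-Reasoning)
open import Data.Product using (∃; _,_)
open import Data.Sum using (_⊎_; inj₁; inj₂)
open import Data.Unit using (⊤; tt)
open import Data.Vec using ([]; _∷_; _++_; lookup; there)
open import Data.Vec.Properties
  using (lookup∘tabulate; lookup⇒[]=; []=⇒lookup; lookup-++ˡ; lookup-++ʳ; ≡-dec)
open import Function using (_∘_)
open import Induction.WellFounded using (Acc; acc)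
open import Relation.Nullary using (Dec; yes; no; ¬?; contradiction)
open import Relation.Nullary.Decidable using (_×-dec_; _→-dec_)
open import Relation.Unary using (Decidable)
open import Relation.Binary.PropositionalEquality

Locating : ∀ {m} → SimpleGraph m → Subset m → Set
Locating G C = ∀ x y → x ≢ y → N G x ∩ C ≢ N G y ∩ C

LocatingOutside : ∀ {m} → SimpleGraph m → Subset m → Set
LocatingOutside G C = ∀ x y → x ∉ C → y ∉ C → x ≢ y → N G x ∩ C ≢ N G y ∩ C

module _ {m} (G : SimpleGraph m) where

  ∈-N⁺ : ∀ {x z} → adj G x z ≡ true → z ∈ N G x
  ∈-N⁺ {x} {z} x~z = lookup⇒[]= z _ (trans (lookup∘tabulate (adj G x) z) x~z)

  ∈-N⁻ : ∀ {x z} → z ∈ N G x → adj G x z ≡ true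
  ∈-N⁻ {x} {z} z∈ = trans (sym (lookup∘tabulate (adj G x) z)) ([]=⇒lookup z∈)

  ∈-N[]⁺ : ∀ {x z} → x ≡ z ⊎ adj G x z ≡ true → z ∈ N[ G ] x
  ∈-N[]⁺ {x} {z} h with lookup (N[ G ] x) z in e
  ... | true  = lookup⇒[]= z _ e
  ... | false with trans (sym (lookup∘tabulate _ z)) e
  ...   | closed-z with x ≟ z | h
  ...     | yes _  | _        with () ← closed-z
  ...     | no x≢z | inj₁ x≡z = contradiction x≡z x≢z
  ...     | no _   | inj₂ x~z with () ← trans (sym x~z) closed-z

  ∈-N[]⁻ : ∀ {x z} → z ∈ N[ G ] x → x ≡ z ⊎ adj G x z ≡ true
  ∈-N[]⁻ {x} {z} z∈ with trans (sym (lookup∘tabulate _ z)) ([]=⇒lookup z∈)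
  ... | closed-z with x ≟ z
  ... | yes x≡z = inj₁ x≡z
  ... | no _    = inj₂ closed-z

  neighbourIn : ∀ {x C} → Nonempty (N G x ∩ C) → ∃ λ z → adj G x z ≡ true × z ∈ C
  neighbourIn {x} {C} (z , z∈) with x∈p∩q⁻ (N G x) C z∈
  ... | z∈N , z∈C = z , ∈-N⁻ z∈N , z∈C

  totallyDominated⇒dominated : ∀ {x C} → Nonempty (N G x ∩ C) → Nonempty (N[ G ] x ∩ C)
  totallyDominated⇒dominated served with neighbourIn served
  ... | z , x~z , z∈C = z , x∈p∩q⁺ (∈-N[]⁺ (inj₂ x~z) , z∈C)

  dominated⇒totallyDominated : ∀ {x C} → Dominating G C → x ∉ C → Nonempty (N G x ∩ C)
  dominated⇒totallyDominated {x} {C} dom x∉C with dom x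
  ... | z , z∈ with x∈p∩q⁻ (N[ G ] x) C z∈
  ...   | z∈N[x] , z∈C with ∈-N[]⁻ {x} z∈N[x]
  ...     | inj₁ refl = contradiction z∈C x∉C
  ...     | inj₂ x~z  = z , x∈p∩q⁺ (∈-N⁺ x~z , z∈C)

  dominating⇒nonempty : ∀ {C} → Dominating G C → Fin m → Nonempty C
  dominating⇒nonempty {C} dom x with dom x
  ... | z , z∈ = z , p∩q⊆q (N[ G ] x) C z∈

  totalDominating⇒nonempty : ∀ {C} → TotalDominating G C → Fin m → Nonempty C
  totalDominating⇒nonempty {C} tot x with tot x
  ... | z , z∈ = z , p∩q⊆q (N G x) C z∈

  N∩-separated : ∀ {x y z C} → z ∈ C → adj G x z ≡ true → adj G y z ≡ false →
                 N G x ∩ C ≢ N G y ∩ C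
  N∩-separated {y = y} {z} {C} z∈C x~z y≁z eq = contradiction (trans (sym y~z) y≁z) λ ()
    where
    y~z : adj G y z ≡ true
    y~z = ∈-N⁻ (p∩q⊆p (N G y) C (subst (z ∈_) eq (x∈p∩q⁺ (∈-N⁺ x~z , z∈C))))

  dominating? : Decidable (Dominating G)
  dominating? C = all? λ x → nonempty? (N[ G ] x ∩ C)

  totalDominating? : Decidable (TotalDominating G)
  totalDominating? C = all? λ x → nonempty? (N G x ∩ C)

  traces≢? : ∀ C x y → Dec (N G x ∩ C ≢ N G y ∩ C)
  traces≢? C x y = ¬? (≡-dec Bool._≟_ (N G x ∩ C) (N G y ∩ C))

  locating? : Decidable (Locating G)
  locating? C = all? λ x → all? λ y → ¬? (x ≟ y) →-dec traces≢? C x y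

  locatingOutside? : Decidable (LocatingOutside G)
  locatingOutside? C = all? λ x → all? λ y →
    ¬? (x ∈? C) →-dec ¬? (y ∈? C) →-dec ¬? (x ≟ y) →-dec traces≢? C x y

isXSet? : ∀ X {m} (G : SimpleGraph m) → Decidable (IsXSet X G)
isXSet? LD  G C = dominating? G C      ×-dec locatingOutside? G C
isXSet? LTD G C = totalDominating? G C ×-dec locatingOutside? G C
isXSet? OLD G C = totalDominating? G C ×-dec locating? G C

MinimumSize : ∀ {m} → (Subset m → Set) → ℕ → Set
MinimumSize P k = (Σ _ λ C → P C × ∣ C ∣ ≡ k) × (∀ C → P C → k ≤ ∣ C ∣)

minimumSize : ∀ {m} {P : Subset m → Set} → Decidable P →
              ∀ C → P C → ∃ λ k → MinimumSize P k × k ≤ ∣ C ∣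
minimumSize {P = P} P? C pC = descend C (<-wellFounded ∣ C ∣) pC
  where
  descend : ∀ C → Acc _<_ ∣ C ∣ → P C → ∃ λ k → MinimumSize P k × k ≤ ∣ C ∣
  descend C (acc smaller) pC with anySubset? (λ D → P? D ×-dec ∣ D ∣ <? ∣ C ∣)
  ... | yes (D , pD , D<C) with descend D (smaller D<C) pD
  ...   | k , minimum , k≤D = k , minimum , ≤-trans k≤D (<⇒≤ D<C)
  descend C _ pC | no ¬smaller =
    ∣ C ∣ , ((C , pC , refl) , λ D pD → ≮⇒≥ (λ D<C → ¬smaller (D , pD , D<C))) , ≤-refl

∣p++q∣≡∣p∣+∣q∣ : ∀ {a b} (p : Subset a) (q : Subset b) → ∣ p ++ q ∣ ≡ ∣ p ∣ + ∣ q ∣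
∣p++q∣≡∣p∣+∣q∣ []            q = refl
∣p++q∣≡∣p∣+∣q∣ (inside  ∷ p) q = cong suc (∣p++q∣≡∣p∣+∣q∣ p q)
∣p++q∣≡∣p∣+∣q∣ (outside ∷ p) q = ∣p++q∣≡∣p∣+∣q∣ p q

module _ {n : ℕ} where

  embed : MVert n → Fin (suc (n + n))
  embed vu      = zero
  embed (vv i)  = suc (i ↑ˡ n)
  embed (vu' i) = suc (n ↑ʳ i)

  classify-embed : ∀ c → classify (embed c) ≡ c
  classify-embed vu                                = refl
  classify-embed (vv i)  rewrite splitAt-↑ˡ n i n = refl
  classify-embed (vu' i) rewrite splitAt-↑ʳ n n i = refl

  embed-classify : ∀ x → embed (classify x) ≡ x
  embed-classify zero = refl
  embed-classify (suc x) with splitAt n x | join-splitAt n n x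
  ... | inj₁ _ | x≡ = cong suc x≡
  ... | inj₂ _ | x≡ = cong suc x≡

  ∀-embed : {P : Fin (suc (n + n)) → Set} → (∀ c → P (embed c)) → ∀ x → P x
  ∀-embed {P} h x = subst P (embed-classify x) (h (classify x))

  adj-M-embed : ∀ (G : SimpleGraph n) c d → adj (M G) (embed c) (embed d) ≡ madj G c d
  adj-M-embed G c d = cong₂ (madj G) (classify-embed c) (classify-embed d)

  doubled : Subset n → Subset (suc (n + n))
  doubled S = outside ∷ (S ++ S)

  ∣doubled∣ : ∀ S → ∣ doubled S ∣ ≡ 2 * ∣ S ∣
  ∣doubled∣ S = trans (∣p++q∣≡∣p∣+∣q∣ S S) (cong (∣ S ∣ +_) (sym (+-identityʳ ∣ S ∣)))

  ∈-doubled-v : ∀ {S i} → i ∈ S → embed (vv i) ∈ doubled S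
  ∈-doubled-v {S} {i} = there ∘ lookup⇒[]= _ _ ∘ trans (lookup-++ˡ S S i) ∘ []=⇒lookup

  ∈-doubled-u : ∀ {S i} → i ∈ S → embed (vu' i) ∈ doubled S
  ∈-doubled-u {S} {i} = there ∘ lookup⇒[]= _ _ ∘ trans (lookup-++ʳ S S i) ∘ []=⇒lookup

  onCopies : (Fin n → Set) → MVert n → Set
  onCopies R vu      = ⊤
  onCopies R (vv i)  = R i
  onCopies R (vu' i) = R i

  onCopies-everywhere : ∀ {R} → (∀ i → R i) → ∀ c → onCopies R c
  onCopies-everywhere r vu      = tt
  onCopies-everywhere r (vv i)  = r i
  onCopies-everywhere r (vu' i) = r i

  ∉-doubled : ∀ {S} c → embed c ∉ doubled S → onCopies (_∉ S) c
  ∉-doubled vu      _ = tt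
  ∉-doubled (vv i)  c∉ = c∉ ∘ ∈-doubled-v
  ∉-doubled (vu' i) c∉ = c∉ ∘ ∈-doubled-u

  data CopyOf (j : Fin n) : MVert n → Set where
    v-copy : CopyOf j (vv j)
    u-copy : CopyOf j (vu' j)

  madj-copy : ∀ G {j c} → CopyOf j c → ∀ i → madj G c (vv i) ≡ adj G j i
  madj-copy G v-copy i = refl
  madj-copy G u-copy i = refl

module Doubling {n} (G : SimpleGraph n) (S : Subset n) (S≠∅ : Nonempty S) where

  trace : MVert n → Subset (suc (n + n))
  trace c = N (M G) (embed c) ∩ doubled S

  ∈-trace⁺ : ∀ c d → madj G c d ≡ true → embed d ∈ doubled S → embed d ∈ trace c
  ∈-trace⁺ c d c~d d∈ =
    x∈p∩q⁺ (∈-N⁺ (M G) {embed c} {embed d} (trans (adj-M-embed G c d) c~d) , d∈)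

  ∈-trace⁻ : ∀ c d → embed d ∈ trace c → madj G c d ≡ true
  ∈-trace⁻ c d d∈ = trans (sym (adj-M-embed G c d))
    (∈-N⁻ (M G) {embed c} {embed d} (p∩q⊆p (N (M G) (embed c)) (doubled S) d∈))

  traces-separated : ∀ c d e → embed e ∈ doubled S →
                     madj G c e ≡ true → madj G d e ≡ false → trace c ≢ trace d
  traces-separated c d e e∈ c~e d≁e = N∩-separated (M G) {embed c} {embed d} {embed e} e∈
    (trans (adj-M-embed G c e) c~e) (trans (adj-M-embed G d e) d≁e)

  copy-trace-nonempty : ∀ {j c} → CopyOf j c → Nonempty (N G j ∩ S) → Nonempty (trace c)
  copy-trace-nonempty {c = c} cj served with neighbourIn G served
  ... | i , j~i , i∈S =
    embed (vv i) , ∈-trace⁺ c (vv i) (trans (madj-copy G cj i) j~i) (∈-doubled-v i∈S)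

  trace-nonempty : ∀ {R} → (∀ j → R j → Nonempty (N G j ∩ S)) →
                   ∀ c → onCopies R c → Nonempty (trace c)
  trace-nonempty _ vu _ =
    let i , i∈S = S≠∅ in embed (vu' i) , ∈-trace⁺ vu (vu' i) refl (∈-doubled-u i∈S)
  trace-nonempty served (vv j)  r = copy-trace-nonempty v-copy (served j r)
  trace-nonempty served (vu' j) r = copy-trace-nonempty u-copy (served j r)

  trace≡⇒⊆ : ∀ {j j′ c d} → CopyOf j c → CopyOf j′ d → trace c ≡ trace d →
             N G j ∩ S ⊆ N G j′ ∩ S
  trace≡⇒⊆ {j} {c = c} {d} cj dj′ eq {i} i∈ with x∈p∩q⁻ (N G j) S i∈
  ... | i∈N , i∈S = x∈p∩q⁺ (∈-N⁺ G (trans (sym (madj-copy G dj′ i)) d~vi) , i∈S)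
    where
    vi∈trace-d : embed (vv i) ∈ trace d
    vi∈trace-d = subst (embed (vv i) ∈_) eq
      (∈-trace⁺ c (vv i) (trans (madj-copy G cj i) (∈-N⁻ G i∈N)) (∈-doubled-v i∈S))
    d~vi : madj G d (vv i) ≡ true
    d~vi = ∈-trace⁻ d (vv i) vi∈trace-d

  trace≡⇒N∩≡ : ∀ {j j′ c d} → CopyOf j c → CopyOf j′ d → trace c ≡ trace d →
               N G j ∩ S ≡ N G j′ ∩ S
  trace≡⇒N∩≡ cj dj′ eq = ⊆-antisym (trace≡⇒⊆ cj dj′ eq) (trace≡⇒⊆ dj′ cj (sym eq))

  u≁v : ∀ {j} → Nonempty (N G j ∩ S) → trace vu ≢ trace (vv j)
  u≁v served with neighbourIn G served
  ... | i , j~i , i∈S = ≢-sym (traces-separated (vv _) vu (vv i) (∈-doubled-v i∈S) j~i refl)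

  u≁u : ∀ {j} → trace vu ≢ trace (vu' j)
  u≁u = let i , i∈S = S≠∅ in traces-separated vu (vu' _) (vu' i) (∈-doubled-u i∈S) refl refl

  v≁u : ∀ {j j′} → Nonempty (N G j ∩ S) → trace (vv j) ≢ trace (vu' j′)
  v≁u served with neighbourIn G served
  ... | i , j~i , i∈S = traces-separated (vv _) (vu' _) (vu' i) (∈-doubled-u i∈S) j~i refl

  traces-distinct : ∀ {R} → (∀ j → R j → Nonempty (N G j ∩ S)) →
                    (∀ j j′ → R j → R j′ → j ≢ j′ → N G j ∩ S ≢ N G j′ ∩ S) →
                    ∀ c d → onCopies R c → onCopies R d → embed c ≢ embed d →
                    trace c ≢ trace d
  traces-distinct served loc vu      vu       _ _  c≢d = contradiction refl c≢d
  traces-distinct served loc vu      (vv j)   _ r  _   = u≁v (served j r)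
  traces-distinct served loc vu      (vu' j)  _ _  _   = u≁u
  traces-distinct served loc (vv j)  vu       r _  _   = ≢-sym (u≁v (served j r))
  traces-distinct served loc (vv j)  (vv j′)  r r′ c≢d =
    loc j j′ r r′ (c≢d ∘ cong (embed ∘ vv)) ∘ trace≡⇒N∩≡ v-copy v-copy
  traces-distinct served loc (vv j)  (vu' j′) r _  _   = v≁u (served j r)
  traces-distinct served loc (vu' j) vu       _ _  _   = ≢-sym u≁u
  traces-distinct served loc (vu' j) (vv j′)  _ r′ _   = ≢-sym (v≁u (served j′ r′))
  traces-distinct served loc (vu' j) (vu' j′) r r′ c≢d =
    loc j j′ r r′ (c≢d ∘ cong (embed ∘ vu')) ∘ trace≡⇒N∩≡ u-copy u-copy

  doubled-dominating : (∀ j → j ∉ S → Nonempty (N G j ∩ S)) → Dominating (M G) (doubled S)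
  doubled-dominating served = ∀-embed dominated
    where
    dominated : ∀ c → Nonempty (N[ M G ] (embed c) ∩ doubled S)
    dominated c with embed c ∈? doubled S
    ... | yes c∈ = embed c , x∈p∩q⁺ (∈-N[]⁺ (M G) {embed c} (inj₁ refl) , c∈)
    ... | no  c∉ = totallyDominated⇒dominated (M G) {embed c}
                     (trace-nonempty served c (∉-doubled c c∉))

  doubled-totalDominating : TotalDominating G S → TotalDominating (M G) (doubled S)
  doubled-totalDominating tot = ∀-embed λ c →
    trace-nonempty (λ j _ → tot j) c (onCopies-everywhere {R = λ _ → ⊤} (λ _ → tt) c)

  doubled-locatingOutside : (∀ j → j ∉ S → Nonempty (N G j ∩ S)) → LocatingOutside G S →
                            LocatingOutside (M G) (doubled S)
  doubled-locatingOutside served loc = ∀-embed λ c → ∀-embed λ d c∉ d∉ →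
    traces-distinct served loc c d (∉-doubled c c∉) (∉-doubled d d∉)

  doubled-locating : TotalDominating G S → Locating G S → Locating (M G) (doubled S)
  doubled-locating tot loc = ∀-embed λ c → ∀-embed λ d →
    traces-distinct {R = λ _ → ⊤} (λ j _ → tot j) (λ j j′ _ _ → loc j j′) c d
      (onCopies-everywhere (λ _ → tt) c) (onCopies-everywhere (λ _ → tt) d)

doubled-isXSet : ∀ X {n} (G : SimpleGraph n) {S} → Fin n → IsXSet X G S →
                 IsXSet X (M G) (doubled S)
doubled-isXSet LD G {S} x (dom , loc) =
  doubled-dominating served , doubled-locatingOutside served loc
  where
  open Doubling G S (dominating⇒nonempty G dom x)
  served : ∀ j → j ∉ S → Nonempty (N G j ∩ S)
  served j = dominated⇒totallyDominated G dom
doubled-isXSet LTD G {S} x (tot , loc) =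
  doubled-totalDominating tot , doubled-locatingOutside (λ j _ → tot j) loc
  where open Doubling G S (totalDominating⇒nonempty G tot x)
doubled-isXSet OLD G {S} x (tot , loc) =
  doubled-totalDominating tot , doubled-locating tot loc
  where open Doubling G S (totalDominating⇒nonempty G tot x)

-- Connectedness is used only for n > 0: a nonempty X-set is what gives u a neighbour in it.
theorem3 : (X : Kind) {n : ℕ} (G : SimpleGraph n) → Connected G →
    Σ (Subset n) (IsXSet X G) →
    (k : ℕ) → IsGamma X G k →
    Σ ℕ (λ k′ → IsGamma X (M G) k′ × k′ ≤ 2 * k)
theorem3 X G (n>0 , _) _ k ((S , S-isX , ∣S∣≡k) , _)
  with minimumSize (isXSet? X (M G)) (doubled S) (doubled-isXSet X G (fromℕ< n>0) S-isX)
... | k′ , γ , k′≤ = k′ , γ , (begin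
  k′              ≤⟨ k′≤ ⟩
  ∣ doubled S ∣   ≡⟨ ∣doubled∣ S ⟩
  2 * ∣ S ∣       ≡⟨ cong (2 *_) ∣S∣≡k ⟩
  2 * k           ∎)
  where open ≤-Reasoning
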